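{- Let $M_1=(S_1,r_1)$, $M_2=(S_2,r_2)$ and $M=(S,r)$ be matroids with $S=S_1\times S_2$. The following are equivalent: (i) $r(Y_1\times Y_2)=r_1(Y_1)\cdot r_2(Y_2)$ for all $Y_1\subseteq S_1$ and $Y_2\subseteq S_2$; (ii) $r(\{e_1\}\times Y_2)=r_1(\{e_1\})\cdot r_2(Y_2)$ for all $e_1\in S_1$, $Y_2\subseteq S_2$; $r(Y_1\times\{e_2\})=r_1(Y_1)\cdot r_2(\{e_2\})$ for all $Y_1\subseteq S_1$, $e_2\in S_2$; and $r(S)=r_1(S_1)\cdot r_2(S_2)$; (iii) $M$ is a coupling of $M_1$ and $M_2$ and $r(\{(e_1,e_2)\})=r_1(\{e_1\})\cdot r_2(\{e_2\})$ for every $(e_1,e_2)\in S$.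
   Context: A matroid $M=(S_1\times S_2,r)$ is a coupling of $M_1=(S_1,r_1)$ and $M_2=(S_2,r_2)$ if $r(X_1\times S_2)=r_1(X_1)r_2(S_2)$ for all $X_1\subseteq S_1$ and $r(S_1\times X_2)=r_1(S_1)r_2(X_2)$ for all $X_2\subseteq S_2$. -}

module Defs where

open import Data.Nat using (ℕ; _+_; _*_; _≤_)
open import Data.Bool using (_∧_)
open import Data.Product using (_×_; _,_)
open import Data.Fin using (Fin; remQuot)
open import Data.Fin.Subset using (Subset; _⊆_; _∪_; _∩_; ∣_∣; ⊤; ⁅_⁆)
open import Relation.Binary.PropositionalEquality using (_≡_)
open import Data.Vec using (lookup; tabulate)

record Matroid (n : ℕ) : Set where
  field
    rank       : Subset n → ℕ
    rank-bound : ∀ X → rank X ≤ ∣ X ∣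
    rank-mono  : ∀ {X Y} → X ⊆ Y → rank X ≤ rank Y
    rank-submod : ∀ X Y → rank (X ∪ Y) + rank (X ∩ Y) ≤ rank X + rank Y
open Matroid public

-- The ground set Fin n₁ × Fin n₂ is identified with Fin (n₁ * n₂)
-- via the bijection remQuot / combine of Data.Fin.
-- Y₁ ×ˢ Y₂ is the Cartesian product of subsets under this identification.
_×ˢ_ : ∀ {n₁ n₂} → Subset n₁ → Subset n₂ → Subset (n₁ * n₂)
_×ˢ_ {n₁} {n₂} Y₁ Y₂ =
  tabulate (λ k → f (remQuot {n₁} n₂ k))
  where
  f : Fin n₁ × Fin n₂ → _
  f (i , j) = lookup Y₁ i ∧ lookup Y₂ j

IsCoupling : ∀ {n₁ n₂} → Matroid (n₁ * n₂) → Matroid n₁ → Matroid n₂ → Set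
IsCoupling {n₁} {n₂} M M₁ M₂ =
  (∀ (X₁ : Subset n₁) → rank M (_×ˢ_ {n₁} {n₂} X₁ ⊤) ≡ rank M₁ X₁ * rank M₂ ⊤)
  × (∀ (X₂ : Subset n₂) → rank M (_×ˢ_ {n₁} {n₂} ⊤ X₂) ≡ rank M₁ ⊤ * rank M₂ X₂)

-- (iii) ⇒ (i). A non-loop e₁ of M₁ gives a row {e₁} × Y₂ of rank r₂(Y₂): when an
-- element e₂ raises r₂, the point (e₁,e₂) is a non-loop of M, and if it were spanned
-- by {e₁} × Y₂ it would be spanned by S₁ × Y₂, so submodularity against S₁ × {e₂}
-- would give r(S₁ × (Y₂ ∪ {e₂})) < r₁(S₁)(r₂(Y₂) + 1). Since a coupling makes
-- X₁ × S₂ and D₁ × S₂ skew whenever X₁ and D₁ are skew in M₁, the rows then add up to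
-- r(Y₁ × Y₂) ≥ r₁(Y₁) r₂(Y₂); choosing D₁ skew to Y₁ with Y₁ ∪ D₁ spanning M₁ and
-- comparing with r(S₁ × Y₂) = r₁(S₁) r₂(Y₂) gives the reverse inequality.
--
-- (ii) ⇒ (i). By induction on Y₂: by the row formulas, an element e₂ not raising r₂
-- leaves the rank of every row {e₁} × Y₂, hence of Y₁ × Y₂, unchanged, while one
-- raising r₂ adds at most r(Y₁ × {e₂}) = r₁(Y₁); this is the upper bound. Columnwise, S₁ × S₂ is spanned by
-- (Y₁ ∪ D₁) × S₂, which together with r(S) = r₁(S₁) r₂(S₂) yields the first coupling
-- equation, and the lower bound follows as in (iii) ⇒ (i).
module Submission where

open import Data.Bool using (true; _∧_)
open import Data.Empty using (⊥-elim)
open import Data.Fin using (Fin; remQuot) renaming (_≟_ to _≟ᶠ_)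
open import Data.Fin.Subset using (Subset; _⊆_; _⊂_; _∪_; _∩_; _∈_; _-_; ⊤; ⊥; ⁅_⁆)
open import Data.Fin.Subset.Induction using (⊂-wellFounded)
open import Data.Fin.Subset.Properties
open import Data.Nat using (ℕ; suc; _+_; _*_; _≤_; _<_; z≤n; s≤s; _≤?_)
open import Data.Nat.Properties
open import Data.Nat.Tactic.RingSolver using (solve-∀)
open import Data.Product using (_×_; _,_; proj₁; proj₂; Σ-syntax; swap)
open import Data.Sum using (_⊎_; inj₁; inj₂)
open import Data.Vec using (lookup; tabulate)
open import Data.Vec.Properties using ([]=⇒lookup; lookup⇒[]=; lookup∘tabulate)
open import Function.Base using (_∘_)
open import Function.Bundles using (_⇔_; mk⇔)
open import Induction.WellFounded using (module All)
open import Level using (0ℓ)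
open import Relation.Binary.PropositionalEquality
open import Relation.Nullary using (yes; no; ¬_)

open import Defs

module _ {n : ℕ} where

  ⊆∪ˡ : {A B : Subset n} → A ⊆ A ∪ B
  ⊆∪ˡ {B = B} = p⊆p∪q B

  ⊆∪ʳ : {A B : Subset n} → B ⊆ A ∪ B
  ⊆∪ʳ {A} {B} = q⊆p∪q A B

  ∪-⊆ : {A B C : Subset n} → A ⊆ C → B ⊆ C → A ∪ B ⊆ C
  ∪-⊆ {A} {B} A⊆C B⊆C x∈A∪B with x∈p∪q⁻ A B x∈A∪B
  ... | inj₁ x∈A = A⊆C x∈A
  ... | inj₂ x∈B = B⊆C x∈B

  ∪-mono : {A A' B B' : Subset n} → A ⊆ A' → B ⊆ B' → A ∪ B ⊆ A' ∪ B'
  ∪-mono A⊆A' B⊆B' = ∪-⊆ (⊆-trans A⊆A' ⊆∪ˡ) (⊆-trans B⊆B' ⊆∪ʳ)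

  ⊆-∩ : {A B C : Subset n} → C ⊆ A → C ⊆ B → C ⊆ A ∩ B
  ⊆-∩ C⊆A C⊆B x∈C = x∈p∩q⁺ (C⊆A x∈C , C⊆B x∈C)

  ⁅⁆-⊆ : {A : Subset n} {x : Fin n} → x ∈ A → ⁅ x ⁆ ⊆ A
  ⁅⁆-⊆ {A} {x} x∈A y∈⁅x⁆ = subst (_∈ A) (sym (x∈⁅y⁆⇒x≡y x y∈⁅x⁆)) x∈A

  p-x∪⁅x⁆≡p : {A : Subset n} {x : Fin n} → x ∈ A → (A - x) ∪ ⁅ x ⁆ ≡ A
  p-x∪⁅x⁆≡p {A} {x} x∈A = ⊆-antisym (∪-⊆ (p─q⊆p A ⁅ x ⁆) (⁅⁆-⊆ x∈A)) ⊆A-x∪⁅x⁆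
    where
    ⊆A-x∪⁅x⁆ : A ⊆ (A - x) ∪ ⁅ x ⁆
    ⊆A-x∪⁅x⁆ {y} y∈A with y ≟ᶠ x
    ... | yes refl = ⊆∪ʳ (x∈⁅x⁆ y)
    ... | no y≢x = ⊆∪ˡ (x∈p∧x≢y⇒x∈p-y y∈A y≢x)

  ∪⁅⁆-induction : (P : Subset n → Set) → P ⊥ → (∀ X x → P X → P (X ∪ ⁅ x ⁆)) → ∀ Y → P Y
  ∪⁅⁆-induction P P-⊥ P-∪⁅⁆ = All.wfRec ⊂-wellFounded 0ℓ P step
    where
    step : ∀ Y → (∀ {Z} → Z ⊂ Y → P Z) → P Y
    step Y ih with nonempty? Y
    ... | no empty = subst P (sym (Empty-unique empty)) P-⊥
    ... | yes (x , x∈Y) = subst P (p-x∪⁅x⁆≡p x∈Y) (P-∪⁅⁆ (Y - x) x (ih (x∈p⇒p-x⊂p x∈Y)))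

module MatroidRank {n : ℕ} (M : Matroid n) where

  private
    r : Subset n → ℕ
    r = rank M

  rank-⊆⊇ : {X Y : Subset n} → X ⊆ Y → Y ⊆ X → r X ≡ r Y
  rank-⊆⊇ X⊆Y Y⊆X = ≤-antisym (rank-mono M X⊆Y) (rank-mono M Y⊆X)

  rank-⊥ : r ⊥ ≡ 0
  rank-⊥ = n≤0⇒n≡0 (≤-trans (rank-bound M ⊥) (≤-reflexive (∣⊥∣≡0 n)))

  rank-∪-≤ : ∀ X Y → r (X ∪ Y) ≤ r X + r Y
  rank-∪-≤ X Y = ≤-trans (m≤m+n _ _) (rank-submod M X Y)

  rank-⁅⁆≤1 : ∀ x → r ⁅ x ⁆ ≤ 1
  rank-⁅⁆≤1 x = ≤-trans (rank-bound M ⁅ x ⁆) (≤-reflexive (∣⁅x⁆∣≡1 x))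

  rank-∪⁅⁆≤ : ∀ X x → r (X ∪ ⁅ x ⁆) ≤ suc (r X)
  rank-∪⁅⁆≤ X x = begin
    r (X ∪ ⁅ x ⁆) ≤⟨ rank-∪-≤ X ⁅ x ⁆ ⟩
    r X + r ⁅ x ⁆ ≤⟨ +-monoʳ-≤ (r X) (rank-⁅⁆≤1 x) ⟩
    r X + 1       ≡⟨ +-comm (r X) 1 ⟩
    suc (r X)     ∎
    where open ≤-Reasoning

  rank-∪⁅⁆ : ∀ X x → r (X ∪ ⁅ x ⁆) ≡ r X ⊎ (r (X ∪ ⁅ x ⁆) ≡ suc (r X) × r ⁅ x ⁆ ≡ 1)
  rank-∪⁅⁆ X x with r (X ∪ ⁅ x ⁆) ≤? r X
  ... | yes ≤rX = inj₁ (≤-antisym ≤rX (rank-mono M ⊆∪ˡ))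
  ... | no ≰rX = inj₂ (grows , nonloop)
    where
    grows : r (X ∪ ⁅ x ⁆) ≡ suc (r X)
    grows = ≤-antisym (rank-∪⁅⁆≤ X x) (≰⇒> ≰rX)
    nonloop : r ⁅ x ⁆ ≡ 1
    nonloop = ≤-antisym (rank-⁅⁆≤1 x) (+-cancelˡ-≤ (r X) 1 (r ⁅ x ⁆) (begin
      r X + 1       ≡⟨ +-comm (r X) 1 ⟩
      suc (r X)     ≡⟨ sym grows ⟩
      r (X ∪ ⁅ x ⁆) ≤⟨ rank-∪-≤ X ⁅ x ⁆ ⟩
      r X + r ⁅ x ⁆ ∎))
      where open ≤-Reasoning

  _Spans_ : Subset n → Subset n → Set
  P Spans Q = r (P ∪ Q) ≡ r P

  ⊆⇒spans : {P Q : Subset n} → Q ⊆ P → P Spans Q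
  ⊆⇒spans Q⊆P = rank-⊆⊇ (∪-⊆ ⊆-refl Q⊆P) ⊆∪ˡ

  rank-≡⇒spans : {P Q : Subset n} → P ⊆ Q → r Q ≡ r P → P Spans Q
  rank-≡⇒spans P⊆Q rQ≡rP = trans (rank-⊆⊇ (∪-⊆ P⊆Q ⊆-refl) ⊆∪ʳ) rQ≡rP

  spans⇒rank-≡ : {P Q : Subset n} → P ⊆ Q → P Spans Q → r Q ≡ r P
  spans⇒rank-≡ P⊆Q P-spans-Q = trans (rank-⊆⊇ ⊆∪ʳ (∪-⊆ P⊆Q ⊆-refl)) P-spans-Q

  spans-⊆ˡ : {P P' Q : Subset n} → P ⊆ P' → P Spans Q → P' Spans Q
  spans-⊆ˡ {P} {P'} {Q} P⊆P' P-spans-Q = ≤-antisym (+-cancelʳ-≤ (r P) _ _ (begin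
    r (P' ∪ Q) + r P                   ≤⟨ +-mono-≤ (rank-mono M (∪-mono ⊆-refl ⊆∪ʳ))
                                                    (rank-mono M (⊆-∩ P⊆P' ⊆∪ˡ)) ⟩
    r (P' ∪ (P ∪ Q)) + r (P' ∩ (P ∪ Q)) ≤⟨ rank-submod M P' (P ∪ Q) ⟩
    r P' + r (P ∪ Q)                   ≡⟨ cong (r P' +_) P-spans-Q ⟩
    r P' + r P                         ∎)) (rank-mono M ⊆∪ˡ)
    where open ≤-Reasoning

  spans-⊆ʳ : {P Q Q' : Subset n} → Q' ⊆ Q → P Spans Q → P Spans Q'
  spans-⊆ʳ Q'⊆Q P-spans-Q =
    ≤-antisym (≤-trans (rank-mono M (∪-mono ⊆-refl Q'⊆Q)) (≤-reflexive P-spans-Q))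
              (rank-mono M ⊆∪ˡ)

  spans-∪ : {P Q Q' : Subset n} → P Spans Q → P Spans Q' → P Spans (Q ∪ Q')
  spans-∪ {P} {Q} {Q'} P-spans-Q P-spans-Q' = begin
    r (P ∪ (Q ∪ Q')) ≡⟨ cong r (∪-assoc P Q Q') ⟨
    r ((P ∪ Q) ∪ Q') ≡⟨ spans-⊆ˡ ⊆∪ˡ P-spans-Q' ⟩
    r (P ∪ Q)        ≡⟨ P-spans-Q ⟩
    r P              ∎
    where open ≡-Reasoning

  ¬spans⇒rank-< : {P Q : Subset n} → ¬ P Spans Q → r P < r (P ∪ Q)
  ¬spans⇒rank-< ¬P-spans-Q = ≤∧≢⇒< (rank-mono M ⊆∪ˡ) (λ eq → ¬P-spans-Q (sym eq))

  spans-∪-≤ : {P Q A B : Subset n} → P ⊆ A → Q ⊆ B → P Spans Q → r (A ∪ B) + r Q ≤ r A + r B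
  spans-∪-≤ {P} {Q} {A} {B} P⊆A Q⊆B P-spans-Q = begin
    r (A ∪ B) + r Q                     ≤⟨ +-mono-≤ (rank-mono M (∪-mono ⊆∪ˡ ⊆-refl))
                                                     (rank-mono M (⊆-∩ ⊆∪ʳ Q⊆B)) ⟩
    r ((A ∪ Q) ∪ B) + r ((A ∪ Q) ∩ B)   ≤⟨ rank-submod M (A ∪ Q) B ⟩
    r (A ∪ Q) + r B                     ≡⟨ cong (_+ r B) (spans-⊆ˡ P⊆A P-spans-Q) ⟩
    r A + r B                           ∎
    where open ≤-Reasoning

  Skew : Subset n → Subset n → Set
  Skew A B = r A + r B ≤ r (A ∪ B)

  skew-⊆ : {A A' B B' : Subset n} → A' ⊆ A → B' ⊆ B → Skew A B → Skew A' B'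
  skew-⊆ {A} {A'} {B} {B'} A'⊆A B'⊆B skew = +-cancelˡ-≤ (r A + r B) _ _ (begin
    (r A + r B) + (r A' + r B') ≤⟨ +-monoˡ-≤ _ (≤-trans skew (rank-mono M (∪-mono ⊆∪ʳ ⊆-refl))) ⟩
    r W + (r A' + r B')         ≡⟨ a+[b+c]≡a+c+b (r W) (r A') (r B') ⟩
    (r W + r B') + r A'         ≤⟨ +-monoˡ-≤ _ (submod-step {V} B (⊆-trans ⊆∪ʳ ⊆∪ˡ) B'⊆B) ⟩
    (r V + r B) + r A'          ≡⟨ a+b+c≡a+c+b (r V) (r B) (r A') ⟩
    (r V + r A') + r B          ≤⟨ +-monoˡ-≤ _ (submod-step {A' ∪ B'} A ⊆∪ˡ A'⊆A) ⟩
    (r (A' ∪ B') + r A) + r B   ≡⟨ a+b+c≡b+c+a (r (A' ∪ B')) (r A) (r B) ⟩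
    (r A + r B) + r (A' ∪ B')   ∎)
    where
    open ≤-Reasoning
    V = (A' ∪ B') ∪ A
    W = V ∪ B
    submod-step : {U : Subset n} (C : Subset n) {C' : Subset n} → C' ⊆ U → C' ⊆ C →
                  r (U ∪ C) + r C' ≤ r U + r C
    submod-step {U} C C'⊆U C'⊆C =
      ≤-trans (+-monoʳ-≤ _ (rank-mono M (⊆-∩ C'⊆U C'⊆C))) (rank-submod M U C)
    a+[b+c]≡a+c+b : ∀ a b c → a + (b + c) ≡ (a + c) + b
    a+[b+c]≡a+c+b = solve-∀
    a+b+c≡a+c+b : ∀ a b c → (a + b) + c ≡ (a + c) + b
    a+b+c≡a+c+b = solve-∀
    a+b+c≡b+c+a : ∀ a b c → (a + b) + c ≡ (b + c) + a
    a+b+c≡b+c+a = solve-∀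

  private
    SkewSpanning : Subset n → Subset n → Set
    SkewSpanning X T = Σ[ D ∈ Subset n ] Skew X D × (X ∪ D) Spans T

    skewSpanning-∪⁅⁆ : ∀ X T t → SkewSpanning X T → SkewSpanning X (T ∪ ⁅ t ⁆)
    skewSpanning-∪⁅⁆ X T t (D , skew , spans-T) with rank-∪⁅⁆ (X ∪ D) t
    ... | inj₁ spans-t = D , skew , spans-∪ spans-T spans-t
    ... | inj₂ (grows , _) = D ∪ ⁅ t ⁆ , skew' , spans-∪ (spans-⊆ˡ XD⊆XD' spans-T) (⊆⇒spans t∈XD')
      where
      open ≤-Reasoning
      XD⊆XD' : X ∪ D ⊆ X ∪ (D ∪ ⁅ t ⁆)
      XD⊆XD' = ∪-mono ⊆-refl ⊆∪ˡ
      t∈XD' : ⁅ t ⁆ ⊆ X ∪ (D ∪ ⁅ t ⁆)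
      t∈XD' y∈⁅t⁆ = ⊆∪ʳ (⊆∪ʳ y∈⁅t⁆)
      skew' : Skew X (D ∪ ⁅ t ⁆)
      skew' = begin
        r X + r (D ∪ ⁅ t ⁆)    ≤⟨ +-monoʳ-≤ (r X) (rank-∪⁅⁆≤ D t) ⟩
        r X + suc (r D)        ≡⟨ +-suc (r X) (r D) ⟩
        suc (r X + r D)        ≤⟨ s≤s skew ⟩
        suc (r (X ∪ D))        ≡⟨ sym grows ⟩
        r ((X ∪ D) ∪ ⁅ t ⁆)    ≡⟨ cong r (∪-assoc X D ⁅ t ⁆) ⟩
        r (X ∪ (D ∪ ⁅ t ⁆))    ∎

    skew-⊥ : ∀ X → Skew X ⊥
    skew-⊥ X = ≤-trans (≤-reflexive (trans (cong (r X +_) rank-⊥) (+-identityʳ (r X)))) (rank-mono M ⊆∪ˡ)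

  spanning-skew-complement : ∀ X → Σ[ D ∈ Subset n ] r (X ∪ D) ≡ r ⊤ × r X + r D ≡ r ⊤
  spanning-skew-complement X
    with ∪⁅⁆-induction (SkewSpanning X) (⊥ , skew-⊥ X , ⊆⇒spans ⊥⊆) (skewSpanning-∪⁅⁆ X) ⊤
  ... | D , skew , spans-⊤ = D , spanning , ≤-antisym (≤-trans skew (≤-reflexive spanning))
                                                      (≤-trans (≤-reflexive (sym spanning)) (rank-∪-≤ X D))
    where
    spanning : r (X ∪ D) ≡ r ⊤
    spanning = sym (spans⇒rank-≡ ⊆⊤ spans-⊤)

-- Products of subsets are taken abstractly so that columns can be treated as the rows
-- of the transposed product.
record SubsetProduct (n₁ n₂ N : ℕ) : Set where
  field
    _⊗_  : Subset n₁ → Subset n₂ → Subset N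
    π₁   : Fin N → Fin n₁
    π₂   : Fin N → Fin n₂
    ∈-⊗⁺ : ∀ {x A B} → π₁ x ∈ A → π₂ x ∈ B → x ∈ A ⊗ B
    ∈-⊗⁻ : ∀ {x A B} → x ∈ A ⊗ B → π₁ x ∈ A × π₂ x ∈ B

transpose : ∀ {n₁ n₂ N} → SubsetProduct n₁ n₂ N → SubsetProduct n₂ n₁ N
transpose P = record
  { _⊗_  = λ B A → A ⊗ B
  ; π₁   = π₂
  ; π₂   = π₁
  ; ∈-⊗⁺ = λ b a → ∈-⊗⁺ a b
  ; ∈-⊗⁻ = λ x∈A⊗B → swap (∈-⊗⁻ x∈A⊗B)
  }
  where open SubsetProduct P

module SubsetProductProperties {n₁ n₂ N} (P : SubsetProduct n₁ n₂ N) where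

  open SubsetProduct P public

  ⊗-mono : {A A' : Subset n₁} {B B' : Subset n₂} → A ⊆ A' → B ⊆ B' → A ⊗ B ⊆ A' ⊗ B'
  ⊗-mono A⊆A' B⊆B' x∈A⊗B = let (a , b) = ∈-⊗⁻ x∈A⊗B in ∈-⊗⁺ (A⊆A' a) (B⊆B' b)

  ⊗-∪ˡ-⊆ : {A A' : Subset n₁} {B : Subset n₂} → (A ∪ A') ⊗ B ⊆ (A ⊗ B) ∪ (A' ⊗ B)
  ⊗-∪ˡ-⊆ {A} {A'} x∈A∪A'⊗B with ∈-⊗⁻ x∈A∪A'⊗B
  ... | a , b with x∈p∪q⁻ A A' a
  ... | inj₁ a' = ⊆∪ˡ (∈-⊗⁺ a' b)
  ... | inj₂ a' = ⊆∪ʳ (∈-⊗⁺ a' b)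

  ⊗-∪ˡ-⊇ : {A A' : Subset n₁} {B : Subset n₂} → (A ⊗ B) ∪ (A' ⊗ B) ⊆ (A ∪ A') ⊗ B
  ⊗-∪ˡ-⊇ = ∪-⊆ (⊗-mono ⊆∪ˡ ⊆-refl) (⊗-mono ⊆∪ʳ ⊆-refl)

  ⊗-∪ʳ-⊇ : {A : Subset n₁} {B B' : Subset n₂} → (A ⊗ B) ∪ (A ⊗ B') ⊆ A ⊗ (B ∪ B')
  ⊗-∪ʳ-⊇ = ∪-⊆ (⊗-mono ⊆-refl ⊆∪ˡ) (⊗-mono ⊆-refl ⊆∪ʳ)

  ⊗-∪ʳ-⊆ : {A : Subset n₁} {B B' : Subset n₂} → A ⊗ (B ∪ B') ⊆ (A ⊗ B) ∪ (A ⊗ B')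
  ⊗-∪ʳ-⊆ {A} {B} {B'} x∈A⊗B∪B' with ∈-⊗⁻ x∈A⊗B∪B'
  ... | a , b with x∈p∪q⁻ B B' b
  ... | inj₁ b' = ⊆∪ˡ (∈-⊗⁺ a b')
  ... | inj₂ b' = ⊆∪ʳ (∈-⊗⁺ a b')

  ⊗-⊥ˡ : {B : Subset n₂} → ⊥ ⊗ B ⊆ ⊥
  ⊗-⊥ˡ x∈⊥⊗B = ⊥-elim (∉⊥ (proj₁ (∈-⊗⁻ x∈⊥⊗B)))

  ⊗-⊥ʳ : {A : Subset n₁} → A ⊗ ⊥ ⊆ ⊥
  ⊗-⊥ʳ x∈A⊗⊥ = ⊥-elim (∉⊥ (proj₂ (∈-⊗⁻ x∈A⊗⊥)))

  ⊤⊗⊤≡⊤ : ⊤ ⊗ ⊤ ≡ ⊤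
  ⊤⊗⊤≡⊤ = ⊆-antisym ⊆⊤ (λ _ → ∈-⊗⁺ ∈⊤ ∈⊤)

module ProductRows {n₁ n₂ N} (M : Matroid N) (P : SubsetProduct n₁ n₂ N) where

  open SubsetProductProperties P
  open MatroidRank M

  rank-⊗-rowwise : ∀ X {Y Y'} → Y ⊆ Y' →
                   (∀ {x} → x ∈ X → rank M (⁅ x ⁆ ⊗ Y') ≡ rank M (⁅ x ⁆ ⊗ Y)) →
                   rank M (X ⊗ Y') ≡ rank M (X ⊗ Y)
  rank-⊗-rowwise X {Y} {Y'} Y⊆Y' rows = spans⇒rank-≡ (⊗-mono ⊆-refl Y⊆Y') (spans-rows X ⊆-refl)
    where
    Rows : Subset n₁ → Set
    Rows Z = Z ⊆ X → (X ⊗ Y) Spans (Z ⊗ Y')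
    add-row : ∀ Z z → Rows Z → Rows (Z ∪ ⁅ z ⁆)
    add-row Z z spans-Z Z∪z⊆X = spans-⊆ʳ ⊗-∪ˡ-⊆ (spans-∪ (spans-Z (⊆-trans ⊆∪ˡ Z∪z⊆X)) spans-z)
      where
      z∈X : z ∈ X
      z∈X = Z∪z⊆X (⊆∪ʳ (x∈⁅x⁆ z))
      spans-z : (X ⊗ Y) Spans (⁅ z ⁆ ⊗ Y')
      spans-z = spans-⊆ˡ (⊗-mono (⁅⁆-⊆ z∈X) ⊆-refl)
                         (rank-≡⇒spans (⊗-mono ⊆-refl Y⊆Y') (rows z∈X))
    spans-rows : ∀ Z → Rows Z
    spans-rows = ∪⁅⁆-induction Rows (λ _ → ⊆⇒spans (⊆-trans ⊗-⊥ˡ ⊥⊆)) add-row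

module ProductRank {n₁ n₂ N} (M₁ : Matroid n₁) (M₂ : Matroid n₂) (M : Matroid N)
                   (P : SubsetProduct n₁ n₂ N) where

  open SubsetProductProperties P
  open MatroidRank M
  open ProductRows M P
  module M₁ = MatroidRank M₁
  module M₂ = MatroidRank M₂
  module Columns = ProductRows M (transpose P)

  private
    r : Subset N → ℕ
    r = rank M
    r₁ : Subset n₁ → ℕ
    r₁ = rank M₁
    r₂ : Subset n₂ → ℕ
    r₂ = rank M₂

    a*m+a*1≡a*[1+m] : ∀ a m → a * m + a * 1 ≡ a * suc m
    a*m+a*1≡a*[1+m] = solve-∀

  ProductFormula : Set
  ProductFormula = ∀ X Y → r (X ⊗ Y) ≡ r₁ X * r₂ Y

  RowFormula : Set
  RowFormula = ∀ a Y → r (⁅ a ⁆ ⊗ Y) ≡ r₁ ⁅ a ⁆ * r₂ Y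

  ColumnFormula : Set
  ColumnFormula = ∀ X b → r (X ⊗ ⁅ b ⁆) ≡ r₁ X * r₂ ⁅ b ⁆

  TotalFormula : Set
  TotalFormula = r ⊤ ≡ r₁ ⊤ * r₂ ⊤

  SingletonFormula : Set
  SingletonFormula = ∀ a b → r (⁅ a ⁆ ⊗ ⁅ b ⁆) ≡ r₁ ⁅ a ⁆ * r₂ ⁅ b ⁆

  Coupling₁ : Set
  Coupling₁ = ∀ X → r (X ⊗ ⊤) ≡ r₁ X * r₂ ⊤

  Coupling₂ : Set
  Coupling₂ = ∀ Y → r (⊤ ⊗ Y) ≡ r₁ ⊤ * r₂ Y

  NonloopRowBound : Set
  NonloopRowBound = ∀ a → r₁ ⁅ a ⁆ ≡ 1 → ∀ Y → r₂ Y ≤ r (⁅ a ⁆ ⊗ Y)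

  skew-⊗ : Coupling₁ → ∀ {X D} → M₁.Skew X D → ∀ Y → Skew (X ⊗ Y) (D ⊗ Y)
  skew-⊗ coupling₁ {X} {D} skew Y = skew-⊆ (⊗-mono ⊆-refl ⊆⊤) (⊗-mono ⊆-refl ⊆⊤) (begin
    r (X ⊗ ⊤) + r (D ⊗ ⊤)      ≡⟨ cong₂ _+_ (coupling₁ X) (coupling₁ D) ⟩
    r₁ X * r₂ ⊤ + r₁ D * r₂ ⊤  ≡⟨ *-distribʳ-+ (r₂ ⊤) (r₁ X) (r₁ D) ⟨
    (r₁ X + r₁ D) * r₂ ⊤       ≤⟨ *-monoˡ-≤ (r₂ ⊤) skew ⟩
    r₁ (X ∪ D) * r₂ ⊤          ≡⟨ coupling₁ (X ∪ D) ⟨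
    r ((X ∪ D) ⊗ ⊤)            ≤⟨ rank-mono M ⊗-∪ˡ-⊆ ⟩
    r ((X ⊗ ⊤) ∪ (D ⊗ ⊤))      ∎)
    where open ≤-Reasoning

  ¬row-spans-nonloop : Coupling₂ → SingletonFormula → ∀ {a Y y} → r₁ ⁅ a ⁆ ≡ 1 →
                       r₂ (Y ∪ ⁅ y ⁆) ≡ suc (r₂ Y) → r₂ ⁅ y ⁆ ≡ 1 →
                       ¬ (⁅ a ⁆ ⊗ Y) Spans (⁅ a ⁆ ⊗ ⁅ y ⁆)
  ¬row-spans-nonloop coupling₂ singles {a} {Y} {y} nonloop₁ grows nonloop₂ spans =
    m+1+n≰m (R * suc m) (begin
      R * suc m + 1                          ≡⟨ cong₂ _+_ column point ⟨
      r (⊤ ⊗ (Y ∪ ⁅ y ⁆)) + r q              ≤⟨ +-monoˡ-≤ _ (rank-mono M ⊗-∪ʳ-⊆) ⟩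
      r ((⊤ ⊗ Y) ∪ (⊤ ⊗ ⁅ y ⁆)) + r q        ≤⟨ spans-∪-≤ (⊗-mono ⊆⊤ ⊆-refl) (⊗-mono ⊆⊤ ⊆-refl) spans ⟩
      r (⊤ ⊗ Y) + r (⊤ ⊗ ⁅ y ⁆)              ≡⟨ cong₂ _+_ (coupling₂ Y) (coupling₂ ⁅ y ⁆) ⟩
      R * m + R * r₂ ⁅ y ⁆                    ≡⟨ cong (λ k → R * m + R * k) nonloop₂ ⟩
      R * m + R * 1                           ≡⟨ a*m+a*1≡a*[1+m] R m ⟩
      R * suc m                               ∎)
    where
    open ≤-Reasoning
    R = r₁ ⊤
    m = r₂ Y
    column : r (⊤ ⊗ (Y ∪ ⁅ y ⁆)) ≡ R * suc m
    column = trans (coupling₂ (Y ∪ ⁅ y ⁆)) (cong (R *_) grows)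
    q = ⁅ a ⁆ ⊗ ⁅ y ⁆
    point : r q ≡ 1
    point = trans (singles a y) (cong₂ _*_ nonloop₁ nonloop₂)

  nonloop-row-bound : Coupling₂ → SingletonFormula → NonloopRowBound
  nonloop-row-bound coupling₂ singles a nonloop₁ =
    ∪⁅⁆-induction (λ Y → r₂ Y ≤ r (⁅ a ⁆ ⊗ Y)) (≤-trans (≤-reflexive M₂.rank-⊥) z≤n) step
    where
    open ≤-Reasoning
    step : ∀ Y y → r₂ Y ≤ r (⁅ a ⁆ ⊗ Y) → r₂ (Y ∪ ⁅ y ⁆) ≤ r (⁅ a ⁆ ⊗ (Y ∪ ⁅ y ⁆))
    step Y y ih with M₂.rank-∪⁅⁆ Y y
    ... | inj₁ same = begin
      r₂ (Y ∪ ⁅ y ⁆)           ≡⟨ same ⟩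
      r₂ Y                     ≤⟨ ih ⟩
      r (⁅ a ⁆ ⊗ Y)            ≤⟨ rank-mono M (⊗-mono ⊆-refl ⊆∪ˡ) ⟩
      r (⁅ a ⁆ ⊗ (Y ∪ ⁅ y ⁆))  ∎
    ... | inj₂ (grows , nonloop₂) = begin
      r₂ (Y ∪ ⁅ y ⁆)                     ≡⟨ grows ⟩
      suc (r₂ Y)                         ≤⟨ s≤s ih ⟩
      suc (r (⁅ a ⁆ ⊗ Y))                ≤⟨ ¬spans⇒rank-< new-point ⟩
      r ((⁅ a ⁆ ⊗ Y) ∪ (⁅ a ⁆ ⊗ ⁅ y ⁆))  ≤⟨ rank-mono M ⊗-∪ʳ-⊇ ⟩
      r (⁅ a ⁆ ⊗ (Y ∪ ⁅ y ⁆))            ∎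
      where
      new-point : ¬ (⁅ a ⁆ ⊗ Y) Spans (⁅ a ⁆ ⊗ ⁅ y ⁆)
      new-point = ¬row-spans-nonloop coupling₂ singles nonloop₁ grows nonloop₂

  rank-⊗-≥ : Coupling₁ → NonloopRowBound → ∀ X Y → r₁ X * r₂ Y ≤ r (X ⊗ Y)
  rank-⊗-≥ coupling₁ rows X Y = ∪⁅⁆-induction (λ X → r₁ X * r₂ Y ≤ r (X ⊗ Y))
    (≤-trans (≤-reflexive (cong (_* r₂ Y) M₁.rank-⊥)) z≤n) step X
    where
    open ≤-Reasoning
    step : ∀ X x → r₁ X * r₂ Y ≤ r (X ⊗ Y) → r₁ (X ∪ ⁅ x ⁆) * r₂ Y ≤ r ((X ∪ ⁅ x ⁆) ⊗ Y)
    step X x ih with M₁.rank-∪⁅⁆ X x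
    ... | inj₁ same = begin
      r₁ (X ∪ ⁅ x ⁆) * r₂ Y  ≡⟨ cong (_* r₂ Y) same ⟩
      r₁ X * r₂ Y            ≤⟨ ih ⟩
      r (X ⊗ Y)              ≤⟨ rank-mono M (⊗-mono ⊆∪ˡ ⊆-refl) ⟩
      r ((X ∪ ⁅ x ⁆) ⊗ Y)    ∎
    ... | inj₂ (grows , nonloop) = begin
      r₁ (X ∪ ⁅ x ⁆) * r₂ Y      ≡⟨ cong (_* r₂ Y) grows ⟩
      r₂ Y + r₁ X * r₂ Y         ≡⟨ +-comm (r₂ Y) _ ⟩
      r₁ X * r₂ Y + r₂ Y         ≤⟨ +-mono-≤ ih (rows x nonloop Y) ⟩
      r (X ⊗ Y) + r (⁅ x ⁆ ⊗ Y)  ≤⟨ skew-⊗ coupling₁ skew Y ⟩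
      r ((X ⊗ Y) ∪ (⁅ x ⁆ ⊗ Y))  ≤⟨ rank-mono M ⊗-∪ˡ-⊇ ⟩
      r ((X ∪ ⁅ x ⁆) ⊗ Y)        ∎
      where
      skew : M₁.Skew X ⁅ x ⁆
      skew = ≤-reflexive (trans (cong (r₁ X +_) nonloop) (trans (+-comm (r₁ X) 1) (sym grows)))

  rank-⊗-≤ : Coupling₁ → Coupling₂ → (∀ X Y → r₁ X * r₂ Y ≤ r (X ⊗ Y)) →
             ∀ X Y → r (X ⊗ Y) ≤ r₁ X * r₂ Y
  rank-⊗-≤ coupling₁ coupling₂ lower X Y with M₁.spanning-skew-complement X
  ... | D , spanning , additive = +-cancelʳ-≤ (r₁ D * r₂ Y) _ _ (begin
    r (X ⊗ Y) + r₁ D * r₂ Y    ≤⟨ +-monoʳ-≤ _ (lower D Y) ⟩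
    r (X ⊗ Y) + r (D ⊗ Y)      ≤⟨ skew-⊗ coupling₁ (≤-reflexive (trans additive (sym spanning))) Y ⟩
    r ((X ⊗ Y) ∪ (D ⊗ Y))      ≤⟨ rank-mono M (∪-⊆ (⊗-mono ⊆⊤ ⊆-refl) (⊗-mono ⊆⊤ ⊆-refl)) ⟩
    r (⊤ ⊗ Y)                  ≡⟨ coupling₂ Y ⟩
    r₁ ⊤ * r₂ Y                ≡⟨ cong (_* r₂ Y) additive ⟨
    (r₁ X + r₁ D) * r₂ Y       ≡⟨ *-distribʳ-+ (r₂ Y) (r₁ X) (r₁ D) ⟩
    r₁ X * r₂ Y + r₁ D * r₂ Y  ∎)
    where open ≤-Reasoning

  coupling⇒product : Coupling₁ → Coupling₂ → SingletonFormula → ProductFormula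
  coupling⇒product coupling₁ coupling₂ singles X Y =
    ≤-antisym (rank-⊗-≤ coupling₁ coupling₂ lower X Y) (lower X Y)
    where
    lower : ∀ X Y → r₁ X * r₂ Y ≤ r (X ⊗ Y)
    lower = rank-⊗-≥ coupling₁ (nonloop-row-bound coupling₂ singles)

  rank-⊗-≤-rows-columns : RowFormula → ColumnFormula → ∀ X Y → r (X ⊗ Y) ≤ r₁ X * r₂ Y
  rank-⊗-≤-rows-columns rows columns X =
    ∪⁅⁆-induction (λ Y → r (X ⊗ Y) ≤ r₁ X * r₂ Y) (≤-trans (≤-reflexive empty) z≤n) step
    where
    open ≤-Reasoning
    empty : r (X ⊗ ⊥) ≡ 0
    empty = trans (rank-⊆⊇ ⊗-⊥ʳ ⊥⊆) rank-⊥
    step : ∀ Y y → r (X ⊗ Y) ≤ r₁ X * r₂ Y → r (X ⊗ (Y ∪ ⁅ y ⁆)) ≤ r₁ X * r₂ (Y ∪ ⁅ y ⁆)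
    step Y y ih with M₂.rank-∪⁅⁆ Y y
    ... | inj₁ same = begin
      r (X ⊗ (Y ∪ ⁅ y ⁆))  ≡⟨ rank-⊗-rowwise X ⊆∪ˡ (λ {x} _ → same-row x) ⟩
      r (X ⊗ Y)            ≤⟨ ih ⟩
      r₁ X * r₂ Y          ≡⟨ cong (r₁ X *_) same ⟨
      r₁ X * r₂ (Y ∪ ⁅ y ⁆) ∎
      where
      same-row : ∀ x → r (⁅ x ⁆ ⊗ (Y ∪ ⁅ y ⁆)) ≡ r (⁅ x ⁆ ⊗ Y)
      same-row x = trans (rows x _) (trans (cong (r₁ ⁅ x ⁆ *_) same) (sym (rows x Y)))
    ... | inj₂ (grows , nonloop) = begin
      r (X ⊗ (Y ∪ ⁅ y ⁆))          ≤⟨ rank-mono M ⊗-∪ʳ-⊆ ⟩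
      r ((X ⊗ Y) ∪ (X ⊗ ⁅ y ⁆))    ≤⟨ rank-∪-≤ _ _ ⟩
      r (X ⊗ Y) + r (X ⊗ ⁅ y ⁆)    ≤⟨ +-monoˡ-≤ _ ih ⟩
      r₁ X * r₂ Y + r (X ⊗ ⁅ y ⁆)  ≡⟨ cong (r₁ X * r₂ Y +_) column ⟩
      r₁ X * r₂ Y + r₁ X * 1       ≡⟨ a*m+a*1≡a*[1+m] (r₁ X) (r₂ Y) ⟩
      r₁ X * suc (r₂ Y)            ≡⟨ cong (r₁ X *_) grows ⟨
      r₁ X * r₂ (Y ∪ ⁅ y ⁆)        ∎
      where
      column : r (X ⊗ ⁅ y ⁆) ≡ r₁ X * 1
      column = trans (columns X y) (cong (r₁ X *_) nonloop)

  rows-columns⇒coupling₁ : RowFormula → ColumnFormula → TotalFormula → Coupling₁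
  rows-columns⇒coupling₁ rows columns total X with M₁.spanning-skew-complement X
  ... | D , spanning , additive = ≤-antisym (upper X ⊤) (+-cancelʳ-≤ (r₁ D * k) _ _ (begin
    r₁ X * k + r₁ D * k    ≡⟨ *-distribʳ-+ k (r₁ X) (r₁ D) ⟨
    (r₁ X + r₁ D) * k      ≡⟨ cong (_* k) additive ⟩
    r₁ ⊤ * k               ≡⟨ total ⟨
    r ⊤                    ≡⟨ cong r ⊤⊗⊤≡⊤ ⟨
    r (⊤ ⊗ ⊤)              ≡⟨ Columns.rank-⊗-rowwise ⊤ ⊆⊤ (λ {y} _ → same-column y) ⟩
    r ((X ∪ D) ⊗ ⊤)        ≤⟨ rank-mono M ⊗-∪ˡ-⊆ ⟩
    r ((X ⊗ ⊤) ∪ (D ⊗ ⊤))  ≤⟨ rank-∪-≤ _ _ ⟩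
    r (X ⊗ ⊤) + r (D ⊗ ⊤)  ≤⟨ +-monoʳ-≤ _ (upper D ⊤) ⟩
    r (X ⊗ ⊤) + r₁ D * k   ∎))
    where
    open ≤-Reasoning
    k = r₂ ⊤
    upper : ∀ X Y → r (X ⊗ Y) ≤ r₁ X * r₂ Y
    upper = rank-⊗-≤-rows-columns rows columns
    same-column : ∀ y → r (⊤ ⊗ ⁅ y ⁆) ≡ r ((X ∪ D) ⊗ ⁅ y ⁆)
    same-column y = trans (columns ⊤ y) (trans (cong (_* r₂ ⁅ y ⁆) (sym spanning)) (sym (columns (X ∪ D) y)))

  rows-columns⇒product : RowFormula → ColumnFormula → TotalFormula → ProductFormula
  rows-columns⇒product rows columns total X Y =
    ≤-antisym (rank-⊗-≤-rows-columns rows columns X Y)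
              (rank-⊗-≥ (rows-columns⇒coupling₁ rows columns total) nonloop-rows X Y)
    where
    nonloop-rows : NonloopRowBound
    nonloop-rows a nonloop Y =
      ≤-reflexive (sym (trans (rows a Y) (trans (cong (_* r₂ Y) nonloop) (*-identityˡ (r₂ Y)))))

cartesian : ∀ {n₁ n₂} → SubsetProduct n₁ n₂ (n₁ * n₂)
cartesian {n₁} {n₂} = record
  { _⊗_  = _×ˢ_
  ; π₁   = λ x → proj₁ (remQuot {n₁} n₂ x)
  ; π₂   = λ x → proj₂ (remQuot {n₁} n₂ x)
  ; ∈-⊗⁺ = λ {x} a b → lookup⇒[]= x _
      (trans (lookup∘tabulate _ x) (cong₂ _∧_ ([]=⇒lookup a) ([]=⇒lookup b)))
  ; ∈-⊗⁻ = λ {x} {A} {B} x∈A×B →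
      let (a , b) = ∧-true (trans (sym (lookup∘tabulate _ x)) ([]=⇒lookup x∈A×B))
      in lookup⇒[]= _ A a , lookup⇒[]= _ B b
  }
  where
  ∧-true : ∀ {a b} → a ∧ b ≡ true → a ≡ true × b ≡ true
  ∧-true {true} {true} _ = refl , refl

theorem3p8 : ∀ {n₁ n₂} (M₁ : Matroid n₁) (M₂ : Matroid n₂) (M : Matroid (n₁ * n₂)) →
    let
      cI = ∀ (Y₁ : Subset n₁) (Y₂ : Subset n₂) → rank M (Y₁ ×ˢ Y₂) ≡ rank M₁ Y₁ * rank M₂ Y₂
      cII = (∀ (e₁ : Fin n₁) (Y₂ : Subset n₂) → rank M (⁅ e₁ ⁆ ×ˢ Y₂) ≡ rank M₁ ⁅ e₁ ⁆ * rank M₂ Y₂)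
            × (∀ (Y₁ : Subset n₁) (e₂ : Fin n₂) → rank M (Y₁ ×ˢ ⁅ e₂ ⁆) ≡ rank M₁ Y₁ * rank M₂ ⁅ e₂ ⁆)
            × (rank M ⊤ ≡ rank M₁ ⊤ * rank M₂ ⊤)
      cIII = IsCoupling M M₁ M₂
             × (∀ (e₁ : Fin n₁) (e₂ : Fin n₂) → rank M (⁅ e₁ ⁆ ×ˢ ⁅ e₂ ⁆) ≡ rank M₁ ⁅ e₁ ⁆ * rank M₂ ⁅ e₂ ⁆)
    in (cI ⇔ cII) × (cII ⇔ cIII)
theorem3p8 {n₁} {n₂} M₁ M₂ M = mk⇔ i⇒ii ii⇒i , mk⇔ (i⇒iii ∘ ii⇒i) (i⇒ii ∘ iii⇒i)
  where
  open ProductRank M₁ M₂ M (cartesian {n₁} {n₂})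
  open SubsetProductProperties (cartesian {n₁} {n₂}) using (⊤⊗⊤≡⊤)

  i⇒ii : ProductFormula → RowFormula × ColumnFormula × TotalFormula
  i⇒ii product = (λ a → product ⁅ a ⁆) , (λ X b → product X ⁅ b ⁆) ,
                 trans (cong (rank M) (sym ⊤⊗⊤≡⊤)) (product ⊤ ⊤)

  ii⇒i : RowFormula × ColumnFormula × TotalFormula → ProductFormula
  ii⇒i (rows , columns , total) = rows-columns⇒product rows columns total

  i⇒iii : ProductFormula → IsCoupling M M₁ M₂ × SingletonFormula
  i⇒iii product = ((λ X → product X ⊤) , product ⊤) , (λ a b → product ⁅ a ⁆ ⁅ b ⁆)

  iii⇒i : IsCoupling M M₁ M₂ × SingletonFormula → ProductFormula
  iii⇒i ((coupling₁ , coupling₂) , singles) = coupling⇒product coupling₁ coupling₂ singles
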